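{- Let $f$ and $g$ be as defined in the context, and assume that (i) $f(n,a)=f(n+1,a)$ for all $a,n\in\mathbb{N}^+$ with $n\ge\lceil\log_2 a\rceil+1$, and (ii) $g(n,m)=g(n+1,m)$ for all $m,n\in\mathbb{N}^+$ with $m\ge 2$ and $n\ge\lceil\log_2 m\rceil$. Then for every $m\in\mathbb{N}^+$ for which there exists $i\in\mathbb{N}^+$ with $\frac{2}{3}2^i\le m\le 2^i$, every union-closed family $\mathcal{F}$ (on any finite ground set $[n]$) with $\mathcal{S}(\mathcal{F})\ne\emptyset$ and $m(\mathcal{F})=m$ satisfies $a(\mathcal{F})\ge \frac{m}{2}$.
   Context: A family $\mathcal{F}$ on ground set $[n]=\{1,\dots,n\}$ is a collection $\mathcal{S}(\mathcal{F})$ of distinct subsets of $[n]$ (elements of $[n]$ may lie in no set); $m(\mathcal{F})=|\mathcal{S}(\mathcal{F})|$. It is union-closed if $S\cup T\in\mathcal{S}(\mathcal{F})$ whenever $S,T\in\mathcal{S}(\mathcal{F})$. For $e\in[n]$, $m_e(\mathcal{F})$ is the number of sets of $\mathcal{F}$ containing $e$, and $a(\mathcal{F})=\max_{e\in[n]}m_e(\mathcal{F})$. For $n,a\in\mathbb{N}^+$, $f(n,a)$ is the maximum of $m(\mathcal{F})$ over all union-closed families $\mathcal{F}$ on ground set $[n]$ with $\mathcal{S}(\mathcal{F})\neq\emptyset$ and $a(\mathcal{F})\le a$. For $n,m\in\mathbb{N}^+$ with $m\ge2$ and $m\le 2^n$, $g(n,m)$ is the minimum of $a(\mathcal{F})$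 over all union-closed families $\mathcal{F}$ on ground set $[n]$ with $m(\mathcal{F})=m$. -}

module Defs where

open import Data.Nat using (ℕ; suc; _≤_; _*_; _^_; _⊔_)
open import Data.Nat.Logarithm using (⌈log₂_⌉)
open import Data.Fin using (Fin)
open import Data.Fin.Subset using (Subset; _∪_; _∈_)
open import Data.Fin.Subset.Properties using (_∈?_)
open import Data.List using (List; length; filter; foldr; map; allFin)
open import Data.List.Relation.Unary.Unique.Propositional using (Unique)
import Data.List.Membership.Propositional as LM
open import Data.Product using (Σ; _×_)
open import Relation.Binary.PropositionalEquality using (_≡_)
open import Relation.Nullary using (¬_)

record Family (n : ℕ) : Set where
  constructor mkFamily
  field
    sets     : List (Subset n)
    distinct : Unique sets
open Family public

mF : ∀ {n} → Family n → ℕ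
mF F = length (sets F)

mₑ : ∀ {n} → Family n → Fin n → ℕ
mₑ F e = length (filter (e ∈?_) (sets F))

-- a(F) = max_e m_e(F)   (0 if n = 0)
aF : ∀ {n} → Family n → ℕ
aF {n} F = foldr _⊔_ 0 (map (mₑ F) (allFin n))

UnionClosed : ∀ {n} → Family n → Set
UnionClosed F = ∀ {S T} → S LM.∈ sets F → T LM.∈ sets F → (S ∪ T) LM.∈ sets F

Nonempty : ∀ {n} → Family n → Set
Nonempty F = ¬ (sets F ≡ Data.List.[])

-- IsF n a v : v = f(n,a), i.e. v is the maximum of m(F) over nonempty
-- union-closed families F on [n] with a(F) ≤ a.
IsF : ℕ → ℕ → ℕ → Set
IsF n a v =
  (Σ (Family n) λ F → UnionClosed F × Nonempty F × aF F ≤ a × mF F ≡ v)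
  × (∀ (F : Family n) → UnionClosed F → Nonempty F → aF F ≤ a → mF F ≤ v)

-- IsG n m v : v = g(n,m), i.e. v is the minimum of a(F) over union-closed
-- families F on [n] with m(F) = m.
IsG : ℕ → ℕ → ℕ → Set
IsG n m v =
  (Σ (Family n) λ F → UnionClosed F × mF F ≡ m × aF F ≡ v)
  × (∀ (F : Family n) → UnionClosed F → mF F ≡ m → v ≤ aF F)

-- f(n,a) = f(n',a)  (both maxima exist, so this says the values agree)
FEq : ℕ → ℕ → ℕ → Set
FEq n n' a = ∀ v w → IsF n a v → IsF n' a w → v ≡ w

GEq : ℕ → ℕ → ℕ → Set
GEq n n' m = ∀ v w → IsG n m v → IsG n' m w → v ≡ w

-- Under (i), f(k, 2^j) ≤ 2^(j+1) for every k: a family on [k] has at most 2^k sets, and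
-- (i) carries this bound from k = j + 1 to all larger k.  Now let F be union-closed with
-- m = m(F) ≥ 2 and 2a(F) < m.  The product power G = F^(R+1) (sets A₀ ⊎ … ⊎ A_R on disjoint
-- copies of the ground set) is union-closed with m(G) = m^(R+1) and a(G) ≤ a(F) m^R.  By
-- pigeonhole on the leading binary digits of the powers of m, some 2^(j+1) lies strictly
-- between (m − 1) m^R and (m + 1) m^R.  Adding 2^j − a(G) new elements, each with a new
-- top set, then yields a union-closed family with a ≤ 2^j but more than 2^(j+1) sets.
module Submission where

open import Defs
open import Data.Bool using (Bool; true; false; _∨_)
open import Data.Fin using (Fin; zero; suc; toℕ; fromℕ<; _↑ˡ_; _↑ʳ_; splitAt; join)
open import Data.Fin.Properties using (join-splitAt; pigeonhole; toℕ-fromℕ<)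
open import Data.Fin.Subset using (Subset; ⊤) renaming (⊥ to ∅)
open import Data.Fin.Subset.Properties using (_∈?_; ∪-zeroˡ; ∪-zeroʳ; ∪-idem)
open import Data.List using (List; []; _∷_; length; filter; map; allFin; cartesianProductWith)
  renaming (_++_ to _++ᴸ_)
open import Data.List.Properties using (length-++; length-map; foldr-preservesᵇ; foldr-preservesᵒ)
open import Data.List.Membership.Propositional using (lose)
open import Data.List.Membership.Propositional.Properties
  using (∈-map⁺; ∈-map⁻; ∈-allFin; ∈-cartesianProductWith⁺; ∈-cartesianProductWith⁻)
open import Data.List.Relation.Unary.All using (All; []; _∷_; universal)
import Data.List.Relation.Unary.All.Properties as All
open import Data.List.Relation.Unary.AllPairs using ([]; _∷_)
open import Data.List.Relation.Unary.Any using (here; there)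
open import Data.List.Relation.Unary.Unique.Propositional using (Unique)
import Data.List.Relation.Unary.Unique.Propositional.Properties as Unique
open import Data.Nat
open import Data.Nat.Properties
open import Data.Nat.DivMod using (_/_; _%_; m≡m%n+[m/n]*n; m%n<n; m/n*n≤m)
open import Data.Nat.Tactic.RingSolver using (solve-∀)
open import Data.Nat.Logarithm using (⌈log₂_⌉; ⌈log₂2^n⌉≡n)
open import Algebra.Properties.CommutativeSemigroup *-commutativeSemigroup using (x∙yz≈y∙xz; x∙yz≈yx∙z; xy∙z≈y∙xz)
open import Data.Product using (Σ; _×_; _,_; proj₁; proj₂; uncurry)
open import Data.Sum using (inj₁; inj₂; [_,_])
open import Data.Vec using (_∷_; []; lookup; _++_; replicate)
open import Data.Vec.Properties using (lookup-++ˡ; lookup-++ʳ; lookup-replicate; ++-injective; ∷-injectiveʳ; zipWith-++)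
open import Relation.Binary.PropositionalEquality using (_≡_; _≢_; refl; sym; trans; cong; cong₂; subst; subst₂; module ≡-Reasoning)
open import Relation.Nullary using (¬_; yes; no; does; contradiction)
open import Relation.Nullary.Decidable using (decidable-stable)
open import Relation.Nullary.Negation using (¬¬-map)

fromBool : Bool → ℕ
fromBool false = 0
fromBool true  = 1

deg : ∀ {n} → Fin n → List (Subset n) → ℕ
deg e []       = 0
deg e (A ∷ As) = fromBool (lookup A e) + deg e As

does-∈? : ∀ {n} (e : Fin n) (A : Subset n) → does (e ∈? A) ≡ lookup A e
does-∈? zero    (true  ∷ A) = refl
does-∈? zero    (false ∷ A) = refl
does-∈? (suc e) (_ ∷ A)     = does-∈? e A

length-filter-∈?≡deg : ∀ {n} (e : Fin n) As → length (filter (e ∈?_) As) ≡ deg e As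
length-filter-∈?≡deg e [] = refl
length-filter-∈?≡deg e (A ∷ As) with does (e ∈? A) | does-∈? e A
... | true  | eq rewrite sym eq = cong suc (length-filter-∈?≡deg e As)
... | false | eq rewrite sym eq = length-filter-∈?≡deg e As

mₑ≡deg : ∀ {n} (F : Family n) e → mₑ F e ≡ deg e (sets F)
mₑ≡deg F e = length-filter-∈?≡deg e (sets F)

aF-lub : ∀ {n k} (F : Family n) → (∀ e → deg e (sets F) ≤ k) → aF F ≤ k
aF-lub {n} {k} F deg≤k = foldr-preservesᵇ {P = _≤ k} {f = _⊔_} ⊔-lub z≤n
  (All.map⁺ (universal (λ e → subst (_≤ k) (sym (mₑ≡deg F e)) (deg≤k e)) (allFin n)))

deg≤aF : ∀ {n} (F : Family n) e → deg e (sets F) ≤ aF F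
deg≤aF {n} F e = subst (_≤ aF F) (mₑ≡deg F e)
  (foldr-preservesᵒ {P = mₑ F e ≤_} {f = _⊔_} (λ x y → [ m≤n⇒m≤n⊔o y , m≤n⇒m≤o⊔n x ]) 0 _
    (inj₂ (lose (∈-map⁺ (mₑ F) (∈-allFin e)) ≤-refl)))

withZero withoutZero : ∀ {k} → List (Subset (suc k)) → List (Subset k)
withZero []                 = []
withZero ((true  ∷ A) ∷ As) = A ∷ withZero As
withZero ((false ∷ A) ∷ As) = withZero As
withoutZero []                 = []
withoutZero ((true  ∷ A) ∷ As) = withoutZero As
withoutZero ((false ∷ A) ∷ As) = A ∷ withoutZero As

length-withZero+withoutZero : ∀ {k} (As : List (Subset (suc k))) →
                              length As ≡ length (withZero As) + length (withoutZero As)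
length-withZero+withoutZero []                 = refl
length-withZero+withoutZero ((true  ∷ A) ∷ As) = cong suc (length-withZero+withoutZero As)
length-withZero+withoutZero ((false ∷ A) ∷ As) =
  trans (cong suc (length-withZero+withoutZero As)) (sym (+-suc _ _))

Unique-withZero : ∀ {k} (As : List (Subset (suc k))) → Unique As → Unique (withZero As)
Unique-withZero []                 []         = []
Unique-withZero ((true  ∷ A) ∷ As) (A∉ ∷ uAs) = notIn As A∉ ∷ Unique-withZero As uAs
  where
  notIn : ∀ Bs → All (true ∷ A ≢_) Bs → All (A ≢_) (withZero Bs)
  notIn []                 []         = []
  notIn ((true  ∷ B) ∷ Bs) (p ∷ ps) = (λ A≡B → p (cong (true ∷_) A≡B)) ∷ notIn Bs ps
  notIn ((false ∷ B) ∷ Bs) (_ ∷ ps) = notIn Bs ps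
Unique-withZero ((false ∷ A) ∷ As) (_ ∷ uAs) = Unique-withZero As uAs

Unique-withoutZero : ∀ {k} (As : List (Subset (suc k))) → Unique As → Unique (withoutZero As)
Unique-withoutZero []                 []         = []
Unique-withoutZero ((true  ∷ A) ∷ As) (_ ∷ uAs) = Unique-withoutZero As uAs
Unique-withoutZero ((false ∷ A) ∷ As) (A∉ ∷ uAs) = notIn As A∉ ∷ Unique-withoutZero As uAs
  where
  notIn : ∀ Bs → All (false ∷ A ≢_) Bs → All (A ≢_) (withoutZero Bs)
  notIn []                 []         = []
  notIn ((true  ∷ B) ∷ Bs) (_ ∷ ps) = notIn Bs ps
  notIn ((false ∷ B) ∷ Bs) (p ∷ ps) = (λ A≡B → p (cong (false ∷_) A≡B)) ∷ notIn Bs ps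

length-Unique≤2^k : ∀ k (As : List (Subset k)) → Unique As → length As ≤ 2 ^ k
length-Unique≤2^k zero    []               _                  = z≤n
length-Unique≤2^k zero    ([] ∷ [])        _                  = ≤-refl
length-Unique≤2^k zero    ([] ∷ [] ∷ _)    ((≢[] ∷ _) ∷ _)    = contradiction refl ≢[]
length-Unique≤2^k (suc k) As uAs = begin
  length As                                        ≡⟨ length-withZero+withoutZero As ⟩
  length (withZero As) + length (withoutZero As)   ≤⟨ +-mono-≤ (length-Unique≤2^k k _ (Unique-withZero As uAs))
                                                               (length-Unique≤2^k k _ (Unique-withoutZero As uAs)) ⟩
  2 ^ k + 2 ^ k                                    ≡⟨ cong (2 ^ k +_) (sym (+-identityʳ (2 ^ k))) ⟩
  2 ^ suc k                                        ∎
  where open ≤-Reasoning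

mF≤2^n : ∀ {n} (F : Family n) → mF F ≤ 2 ^ n
mF≤2^n {n} F = length-Unique≤2^k n (sets F) (distinct F)

-- Product families and their powers

deg-++ : ∀ {n} (e : Fin n) As Bs → deg e (As ++ᴸ Bs) ≡ deg e As + deg e Bs
deg-++ e []       Bs = refl
deg-++ e (A ∷ As) Bs =
  trans (cong (fromBool (lookup A e) +_) (deg-++ e As Bs)) (sym (+-assoc (fromBool (lookup A e)) (deg e As) (deg e Bs)))

deg-map-++ˡ : ∀ {n₁ n₂} (i : Fin n₁) A (Bs : List (Subset n₂)) →
              deg (i ↑ˡ n₂) (map (A ++_) Bs) ≡ fromBool (lookup A i) * length Bs
deg-map-++ˡ i A []       = sym (*-zeroʳ (fromBool (lookup A i)))
deg-map-++ˡ {n₂ = n₂} i A (B ∷ Bs) = begin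
  fromBool (lookup (A ++ B) (i ↑ˡ n₂)) + deg (i ↑ˡ n₂) (map (A ++_) Bs)
    ≡⟨ cong₂ _+_ (cong fromBool (lookup-++ˡ A B i)) (deg-map-++ˡ i A Bs) ⟩
  fromBool (lookup A i) + fromBool (lookup A i) * length Bs
    ≡⟨ sym (*-suc (fromBool (lookup A i)) (length Bs)) ⟩
  fromBool (lookup A i) * suc (length Bs) ∎
  where open ≡-Reasoning

deg-map-++ʳ : ∀ {n₁ n₂} (j : Fin n₂) (A : Subset n₁) Bs → deg (n₁ ↑ʳ j) (map (A ++_) Bs) ≡ deg j Bs
deg-map-++ʳ j A []       = refl
deg-map-++ʳ j A (B ∷ Bs) = cong₂ _+_ (cong fromBool (lookup-++ʳ A B j)) (deg-map-++ʳ j A Bs)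

infixr 7 _⊠_
_⊠_ : ∀ {n₁ n₂} → List (Subset n₁) → List (Subset n₂) → List (Subset (n₁ + n₂))
_⊠_ = cartesianProductWith _++_

length-⊠ : ∀ {n₁ n₂} (As : List (Subset n₁)) (Bs : List (Subset n₂)) → length (As ⊠ Bs) ≡ length As * length Bs
length-⊠ []       Bs = refl
length-⊠ (A ∷ As) Bs =
  trans (length-++ (map (A ++_) Bs)) (cong₂ _+_ (length-map (A ++_) Bs) (length-⊠ As Bs))

deg-⊠ˡ : ∀ {n₁ n₂} (i : Fin n₁) As (Bs : List (Subset n₂)) → deg (i ↑ˡ n₂) (As ⊠ Bs) ≡ deg i As * length Bs
deg-⊠ˡ i [] Bs = refl
deg-⊠ˡ {n₂ = n₂} i (A ∷ As) Bs = begin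
  deg (i ↑ˡ n₂) (map (A ++_) Bs ++ᴸ As ⊠ Bs)
    ≡⟨ deg-++ (i ↑ˡ n₂) (map (A ++_) Bs) (As ⊠ Bs) ⟩
  deg (i ↑ˡ n₂) (map (A ++_) Bs) + deg (i ↑ˡ n₂) (As ⊠ Bs)
    ≡⟨ cong₂ _+_ (deg-map-++ˡ i A Bs) (deg-⊠ˡ i As Bs) ⟩
  fromBool (lookup A i) * length Bs + deg i As * length Bs
    ≡⟨ sym (*-distribʳ-+ (length Bs) (fromBool (lookup A i)) (deg i As)) ⟩
  deg i (A ∷ As) * length Bs ∎
  where open ≡-Reasoning

deg-⊠ʳ : ∀ {n₁ n₂} (j : Fin n₂) (As : List (Subset n₁)) Bs → deg (n₁ ↑ʳ j) (As ⊠ Bs) ≡ length As * deg j Bs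
deg-⊠ʳ j []       Bs = refl
deg-⊠ʳ {n₁} j (A ∷ As) Bs =
  trans (deg-++ (n₁ ↑ʳ j) (map (A ++_) Bs) (As ⊠ Bs)) (cong₂ _+_ (deg-map-++ʳ j A Bs) (deg-⊠ʳ j As Bs))

infixr 7 _⊗_
_⊗_ : ∀ {n₁ n₂} → Family n₁ → Family n₂ → Family (n₁ + n₂)
F ⊗ G = mkFamily (sets F ⊠ sets G)
  (Unique.cartesianProductWith⁺ _++_ (λ {A} {A′} → ++-injective A A′) (distinct F) (distinct G))

⊗-unionClosed : ∀ {n₁ n₂} (F : Family n₁) (G : Family n₂) → UnionClosed F → UnionClosed G → UnionClosed (F ⊗ G)
⊗-unionClosed F G ucF ucG S∈ T∈
  with A , B , A∈ , B∈ , refl ← ∈-cartesianProductWith⁻ _++_ (sets F) (sets G) S∈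
     | A′ , B′ , A′∈ , B′∈ , refl ← ∈-cartesianProductWith⁻ _++_ (sets F) (sets G) T∈
  rewrite zipWith-++ _∨_ A B A′ B′
  = ∈-cartesianProductWith⁺ _++_ (ucF A∈ A′∈) (ucG B∈ B′∈)

mF-⊗ : ∀ {n₁ n₂} (F : Family n₁) (G : Family n₂) → mF (F ⊗ G) ≡ mF F * mF G
mF-⊗ F G = length-⊠ (sets F) (sets G)

aF-⊗ : ∀ {n₁ n₂} (F : Family n₁) (G : Family n₂) → aF (F ⊗ G) ≤ aF F * mF G ⊔ mF F * aF G
aF-⊗ {n₁} {n₂} F G = aF-lub (F ⊗ G) (λ e → deg≤ e (splitAt n₁ e) (join-splitAt n₁ n₂ e))
  where
  deg≤ : ∀ e s → join n₁ n₂ s ≡ e → deg e (sets (F ⊗ G)) ≤ aF F * mF G ⊔ mF F * aF G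
  deg≤ _ (inj₁ i) refl = m≤n⇒m≤n⊔o _ (subst (_≤ aF F * mF G) (sym (deg-⊠ˡ i (sets F) (sets G)))
                                        (*-monoˡ-≤ (mF G) (deg≤aF F i)))
  deg≤ _ (inj₂ j) refl = m≤n⇒m≤o⊔n _ (subst (_≤ mF F * aF G) (sym (deg-⊠ʳ j (sets F) (sets G)))
                                        (*-monoʳ-≤ (mF F) (deg≤aF G j)))

singleton∅ : ∀ n → Family n
singleton∅ n = mkFamily (∅ ∷ []) ([] ∷ [])

singleton∅-unionClosed : ∀ n → UnionClosed (singleton∅ n)
singleton∅-unionClosed n (here refl) (here refl) = here (∪-idem ∅)

singleton∅-nonempty : ∀ n → Nonempty (singleton∅ n)
singleton∅-nonempty n ()

aF-singleton∅ : ∀ n → aF (singleton∅ n) ≡ 0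
aF-singleton∅ n = n≤0⇒n≡0 (aF-lub (singleton∅ n) λ e →
  ≤-reflexive (cong (λ b → fromBool b + 0) (lookup-replicate e false)))

infixr 8 _^ᶠ_
_^ᶠ_ : ∀ {n} → Family n → (r : ℕ) → Family (r * n)
F ^ᶠ zero  = singleton∅ 0
F ^ᶠ suc r = F ⊗ F ^ᶠ r

^ᶠ-unionClosed : ∀ {n} (F : Family n) → UnionClosed F → ∀ r → UnionClosed (F ^ᶠ r)
^ᶠ-unionClosed F uc zero    = singleton∅-unionClosed 0
^ᶠ-unionClosed F uc (suc r) = ⊗-unionClosed F (F ^ᶠ r) uc (^ᶠ-unionClosed F uc r)

mF-^ᶠ : ∀ {n} (F : Family n) r → mF (F ^ᶠ r) ≡ mF F ^ r
mF-^ᶠ F zero    = refl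
mF-^ᶠ F (suc r) = trans (mF-⊗ F (F ^ᶠ r)) (cong (mF F *_) (mF-^ᶠ F r))

aF-^ᶠ-suc : ∀ {n} (F : Family n) r → aF (F ^ᶠ suc r) ≤ aF F * mF F ^ r

-- Stated with the factor m(F) moved to the left so that it also holds for r = 0.
mF*aF-^ᶠ : ∀ {n} (F : Family n) r → mF F * aF (F ^ᶠ r) ≤ aF F * mF F ^ r
mF*aF-^ᶠ F zero rewrite aF-singleton∅ 0 | *-zeroʳ (mF F) = z≤n
mF*aF-^ᶠ F (suc r) = begin
  mF F * aF (F ^ᶠ suc r)        ≤⟨ *-monoʳ-≤ (mF F) (aF-^ᶠ-suc F r) ⟩
  mF F * (aF F * mF F ^ r)      ≡⟨ x∙yz≈y∙xz (mF F) (aF F) (mF F ^ r) ⟩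
  aF F * mF F ^ suc r           ∎
  where open ≤-Reasoning

aF-^ᶠ-suc F r = ≤-trans (aF-⊗ F (F ^ᶠ r))
  (⊔-lub (≤-reflexive (cong (aF F *_) (mF-^ᶠ F r))) (mF*aF-^ᶠ F r))

-- Adding new top sets

extendByTop : ∀ {n} → Family n → Family (suc n)
extendByTop G = mkFamily ((true ∷ ⊤) ∷ map (false ∷_) (sets G))
  (All.map⁺ (universal (λ _ ()) (sets G)) ∷ Unique.map⁺ ∷-injectiveʳ (distinct G))

extendByTop-unionClosed : ∀ {n} (G : Family n) → UnionClosed G → UnionClosed (extendByTop G)
extendByTop-unionClosed G uc (here refl) (here refl) = here (cong (true ∷_) (∪-idem ⊤))
extendByTop-unionClosed G uc (here refl) (there T∈) with B , _ , refl ← ∈-map⁻ (false ∷_) T∈ =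
  here (cong (true ∷_) (∪-zeroˡ B))
extendByTop-unionClosed G uc (there S∈) (here refl) with A , _ , refl ← ∈-map⁻ (false ∷_) S∈ =
  here (cong (true ∷_) (∪-zeroʳ A))
extendByTop-unionClosed G uc (there S∈) (there T∈)
  with A , A∈ , refl ← ∈-map⁻ (false ∷_) S∈ | B , B∈ , refl ← ∈-map⁻ (false ∷_) T∈ =
  there (∈-map⁺ (false ∷_) (uc A∈ B∈))

mF-extendByTop : ∀ {n} (G : Family n) → mF (extendByTop G) ≡ suc (mF G)
mF-extendByTop G = cong suc (length-map (false ∷_) (sets G))

deg-zero-map-false∷ : ∀ {n} (As : List (Subset n)) → deg zero (map (false ∷_) As) ≡ 0
deg-zero-map-false∷ []       = refl
deg-zero-map-false∷ (A ∷ As) = deg-zero-map-false∷ As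

deg-suc-map-false∷ : ∀ {n} (e : Fin n) As → deg (suc e) (map (false ∷_) As) ≡ deg e As
deg-suc-map-false∷ e []       = refl
deg-suc-map-false∷ e (A ∷ As) = cong (fromBool (lookup A e) +_) (deg-suc-map-false∷ e As)

aF-extendByTop : ∀ {n} (G : Family n) → aF (extendByTop G) ≤ suc (aF G)
aF-extendByTop G = aF-lub (extendByTop G) deg≤
  where
  deg≤ : ∀ e → deg e (sets (extendByTop G)) ≤ suc (aF G)
  deg≤ zero    rewrite deg-zero-map-false∷ (sets G) = s≤s z≤n
  deg≤ (suc e) rewrite lookup-replicate e true | deg-suc-map-false∷ e (sets G) = s≤s (deg≤aF G e)

extendByTops : ∀ {n} (t : ℕ) → Family n → Family (t + n)
extendByTops zero    G = G
extendByTops (suc t) G = extendByTop (extendByTops t G)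

extendByTops-unionClosed : ∀ {n} t (G : Family n) → UnionClosed G → UnionClosed (extendByTops t G)
extendByTops-unionClosed zero    G uc = uc
extendByTops-unionClosed (suc t) G uc =
  extendByTop-unionClosed (extendByTops t G) (extendByTops-unionClosed t G uc)

mF-extendByTops : ∀ {n} t (G : Family n) → mF (extendByTops t G) ≡ t + mF G
mF-extendByTops zero    G = refl
mF-extendByTops (suc t) G = trans (mF-extendByTop (extendByTops t G)) (cong suc (mF-extendByTops t G))

aF-extendByTops : ∀ {n} t (G : Family n) → aF (extendByTops t G) ≤ t + aF G
aF-extendByTops zero    G = ≤-refl
aF-extendByTops (suc t) G = ≤-trans (aF-extendByTop (extendByTops t G)) (s≤s (aF-extendByTops t G))

-- Hypothesis (i) bounds f(k, 2 ^ j)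

¬¬-maximum : (P : ℕ → Set) (b : ℕ) → (∀ {v} → P v → v ≤ b) → Σ ℕ P →
             ¬ ¬ Σ ℕ λ v → P v × (∀ {w} → P w → w ≤ v)
¬¬-maximum P zero    P≤0   (v , pv) ¬max = ¬max (v , pv , λ pw → ≤-trans (P≤0 pw) z≤n)
¬¬-maximum P (suc b) P≤1+b inhabited ¬max = ¬¬-maximum P b P≤b inhabited ¬max
  where
  P≤b : ∀ {w} → P w → w ≤ b
  P≤b pw with m≤n⇒m<n∨m≡n (P≤1+b pw)
  ... | inj₁ w<1+b = s≤s⁻¹ w<1+b
  ... | inj₂ refl  = contradiction (suc b , pw , λ {w} → P≤1+b {w}) ¬max

Feasible : ℕ → ℕ → ℕ → Set
Feasible k a v = Σ (Family k) λ G → UnionClosed G × Nonempty G × aF G ≤ a × mF G ≡ v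

-- Union-closedness is not decidable, so the maximum f(k, a) exists only up to double negation.
¬¬-IsF : ∀ k a → ¬ ¬ Σ ℕ (IsF k a)
¬¬-IsF k a = ¬¬-map maximum⇒IsF
  (¬¬-maximum (Feasible k a) (2 ^ k) (λ (G , _ , _ , _ , mG≡v) → subst (_≤ 2 ^ k) mG≡v (mF≤2^n G))
    (1 , singleton∅ k , singleton∅-unionClosed k , singleton∅-nonempty k ,
     subst (_≤ a) (sym (aF-singleton∅ k)) z≤n , refl))
  where
  maximum⇒IsF : (Σ ℕ λ v → Feasible k a v × (∀ {w} → Feasible k a w → w ≤ v)) → Σ ℕ (IsF k a)
  maximum⇒IsF (v , feasible , max) = v , feasible , λ G uc ne aG≤a → max (G , uc , ne , aG≤a , refl)

IsF⇒≤2^n : ∀ {k a v} → IsF k a v → v ≤ 2 ^ k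
IsF⇒≤2^n ((G , _ , _ , _ , refl) , _) = mF≤2^n G

FStable : Set
FStable = ∀ (n a : ℕ) → 1 ≤ a → 1 ≤ n → ⌈log₂ a ⌉ + 1 ≤ n → FEq n (suc n) a

IsF[2^j]⇒≤2^[1+j] : FStable → ∀ j k {v} → IsF k (2 ^ j) v → v ≤ 2 ^ suc j
IsF[2^j]⇒≤2^[1+j] stable j zero    isF = ≤-trans (IsF⇒≤2^n isF) (^-monoʳ-≤ 2 {0} {suc j} z≤n)
IsF[2^j]⇒≤2^[1+j] stable j (suc k) isF with k ≤? j
... | yes k≤j = ≤-trans (IsF⇒≤2^n isF) (^-monoʳ-≤ 2 (s≤s k≤j))
... | no  k≰j = decidable-stable (_ ≤? _) λ v≰2^[1+j] → ¬¬-IsF k (2 ^ j) λ (w , isFw) →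
  v≰2^[1+j] (subst (_≤ 2 ^ suc j) (f[k]≡f[1+k] w _ isFw isF) (IsF[2^j]⇒≤2^[1+j] stable j k isFw))
  where
  j<k : j < k
  j<k = ≰⇒> k≰j
  f[k]≡f[1+k] : FEq k (suc k) (2 ^ j)
  f[k]≡f[1+k] = stable k (2 ^ j) (m^n>0 2 j) (≤-trans (s≤s z≤n) j<k)
    (subst (_≤ k) (sym (trans (cong (_+ 1) (⌈log₂2^n⌉≡n j)) (+-comm j 1))) j<k)

-- A power of 2 close to a power of m

n<2^n : ∀ n → n < 2 ^ n
n<2^n zero    = z<s
n<2^n (suc n) = begin-strict
  suc n          ≤⟨ n<2^n n ⟩
  2 ^ n          <⟨ m<m+n (2 ^ n) (m^n>0 2 n) ⟩
  2 ^ n + 2 ^ n  ≡⟨ cong (2 ^ n +_) (sym (+-identityʳ (2 ^ n))) ⟩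
  2 ^ suc n      ∎
  where open ≤-Reasoning

2^m<2^n⇒m<n : ∀ {m n} → 2 ^ m < 2 ^ n → m < n
2^m<2^n⇒m<n {m} {n} 2^m<2^n with m <? n
... | yes m<n = m<n
... | no  m≮n = contradiction (^-monoʳ-≤ 2 (≮⇒≥ m≮n)) (<⇒≱ 2^m<2^n)

binaryExponent : ∀ P → 0 < P → Σ ℕ λ J → 2 ^ J ≤ P × P < 2 ^ suc J
binaryExponent P 0<P = search P (n<2^n P)
  where
  search : ∀ k → P < 2 ^ k → Σ ℕ λ J → 2 ^ J ≤ P × P < 2 ^ suc J
  search zero    P<1 = contradiction P<1 (≤⇒≯ 0<P)
  search (suc k) P<2^[1+k] with P <? 2 ^ k
  ... | yes P<2^k = search k P<2^k
  ... | no  P≮2^k = k , ≮⇒≥ P≮2^k , P<2^[1+k]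

record LeadingDigits (m P : ℕ) : Set where
  field
    J B           : ℕ
    2^J≤P         : 2 ^ J ≤ P
    P<2^[1+J]     : P < 2 ^ suc J
    m≤B           : m ≤ B
    B<2m          : B < 2 * m
    B*2^J≤m*P     : B * 2 ^ J ≤ m * P
    m*P<[1+B]*2^J : m * P < suc B * 2 ^ J

leadingDigits : ∀ m P .{{_ : NonZero m}} → 0 < P → LeadingDigits m P
leadingDigits m P 0<P = record
  { J = J ; B = B ; 2^J≤P = 2^J≤P ; P<2^[1+J] = P<2^[1+J] ; m≤B = m≤B ; B<2m = B<2m
  ; B*2^J≤m*P = m/n*n≤m (m * P) (2 ^ J) ; m*P<[1+B]*2^J = m*P<[1+B]*2^J }
  where
  open ≤-Reasoning
  J = proj₁ (binaryExponent P 0<P)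
  2^J≤P = proj₁ (proj₂ (binaryExponent P 0<P))
  P<2^[1+J] = proj₂ (proj₂ (binaryExponent P 0<P))
  instance
    2^J≢0 : NonZero (2 ^ J)
    2^J≢0 = m^n≢0 2 J
  B = m * P / 2 ^ J
  m*P<[1+B]*2^J : m * P < suc B * 2 ^ J
  m*P<[1+B]*2^J = begin-strict
    m * P                      ≡⟨ m≡m%n+[m/n]*n (m * P) (2 ^ J) ⟩
    m * P % 2 ^ J + B * 2 ^ J  <⟨ +-monoˡ-< (B * 2 ^ J) (m%n<n (m * P) (2 ^ J)) ⟩
    suc B * 2 ^ J              ∎
  m≤B : m ≤ B
  m≤B = s≤s⁻¹ (*-cancelʳ-< (2 ^ J) m (suc B) (≤-<-trans (*-monoʳ-≤ m 2^J≤P) m*P<[1+B]*2^J))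
  B<2m : B < 2 * m
  B<2m = *-cancelʳ-< (2 ^ J) B (2 * m) (begin-strict
    B * 2 ^ J      ≤⟨ m/n*n≤m (m * P) (2 ^ J) ⟩
    m * P          <⟨ *-monoʳ-< m P<2^[1+J] ⟩
    m * (2 * 2 ^ J) ≡⟨ x∙yz≈yx∙z m 2 (2 ^ J) ⟩
    2 * m * 2 ^ J  ∎)

sameQuotient⇒ratioBounds : ∀ {B x y u v} .{{_ : NonZero v}} → B * x ≤ y → y < suc B * x →
  B * (x * u) ≤ y * v → y * v < suc B * (x * u) → B * u < suc B * v × B * v < suc B * u
sameQuotient⇒ratioBounds {B} {x} {y} {u} {v} Bx≤y y<[1+B]x Bxu≤yv yv<[1+B]xu = upper , lower
  where
  open ≤-Reasoning
  upper : B * u < suc B * v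
  upper = *-cancelˡ-< x _ _ (begin-strict
    x * (B * u)      ≡⟨ x∙yz≈y∙xz x B u ⟩
    B * (x * u)      ≤⟨ Bxu≤yv ⟩
    y * v            <⟨ *-monoˡ-< v y<[1+B]x ⟩
    suc B * x * v    ≡⟨ xy∙z≈y∙xz (suc B) x v ⟩
    x * (suc B * v)  ∎)
  lower : B * v < suc B * u
  lower = *-cancelˡ-< x _ _ (begin-strict
    x * (B * v)      ≡⟨ x∙yz≈yx∙z x B v ⟩
    B * x * v        ≤⟨ *-monoˡ-≤ v Bx≤y ⟩
    y * v            <⟨ yv<[1+B]xu ⟩
    suc B * (x * u)  ≡⟨ x∙yz≈y∙xz (suc B) x u ⟩
    x * (suc B * u)  ∎)

[1+B]*[m*v]≤B*[[1+m]*v] : ∀ {m B} v → m ≤ B → suc B * (m * v) ≤ B * (suc m * v)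
[1+B]*[m*v]≤B*[[1+m]*v] {m} {B} v m≤B = begin
  m * v + B * (m * v)  ≤⟨ +-monoˡ-≤ (B * (m * v)) (*-monoˡ-≤ v m≤B) ⟩
  B * v + B * (m * v)  ≡⟨ sym (*-distribˡ-+ B v (m * v)) ⟩
  B * (v + m * v)      ∎
  where open ≤-Reasoning

ratioBounds⇒near : ∀ {m B u v} .{{_ : NonZero m}} → m ≤ B →
  B * u < suc B * (m * v) → B * (m * v) < suc B * u → pred m * v < u × u < suc m * v
ratioBounds⇒near {m} {B} {u} {v} m≤B Bu<[1+B]mv Bmv<[1+B]u = lower , upper
  where
  open ≤-Reasoning
  lower : pred m * v < u
  lower = *-cancelˡ-< (suc B) _ _ (begin-strict
    suc B * (pred m * v)    ≤⟨ [1+B]*[m*v]≤B*[[1+m]*v] v (≤-trans pred[n]≤n m≤B) ⟩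
    B * (suc (pred m) * v)  ≡⟨ cong (λ k → B * (k * v)) (suc-pred m) ⟩
    B * (m * v)             <⟨ Bmv<[1+B]u ⟩
    suc B * u               ∎)
  upper : u < suc m * v
  upper = *-cancelˡ-< B _ _ (begin-strict
    B * u                <⟨ Bu<[1+B]mv ⟩
    suc B * (m * v)      ≤⟨ [1+B]*[m*v]≤B*[[1+m]*v] v m≤B ⟩
    B * (suc m * v)      ∎)

pigeonholeℕ : ∀ m (f : ℕ → ℕ) → (∀ r → f r < m) → Σ ℕ λ r₁ → Σ ℕ λ r₂ → r₁ < r₂ × f r₁ ≡ f r₂
pigeonholeℕ m f f<m with i , j , i<j , fi≡fj ← pigeonhole (n<1+n m) (λ r → fromℕ< (f<m (toℕ r))) =
  toℕ i , toℕ j , i<j ,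
  trans (sym (toℕ-fromℕ< (f<m (toℕ i)))) (trans (cong toℕ fi≡fj) (toℕ-fromℕ< (f<m (toℕ j))))

sameLeadingDigits⇒near : ∀ {m P₁ P₂ w} .{{_ : NonZero m}} .{{_ : NonZero w}} →
  (d₁ : LeadingDigits m P₁) (d₂ : LeadingDigits m P₂) → P₂ ≡ P₁ * (m * w) →
  LeadingDigits.B d₁ ≡ LeadingDigits.B d₂ →
  Σ ℕ λ D → pred m * w < 2 ^ D × 2 ^ D < suc m * w
sameLeadingDigits⇒near {m} {P₁} {P₂} {w} d₁ d₂ P₂≡P₁*m*w B≡B₂ =
  J₂ ∸ J₁ , uncurry (ratioBounds⇒near m≤B)
    (sameQuotient⇒ratioBounds {B} {2 ^ J₁} {m * P₁} B*2^J≤m*P m*P<[1+B]*2^J lower upper)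
  where
  open LeadingDigits d₁
  open LeadingDigits d₂ using () renaming (J to J₂; B to B₂)
  module d₂ = LeadingDigits d₂
  open ≤-Reasoning
  instance
    m*w≢0 : NonZero (m * w)
    m*w≢0 = m*n≢0 m w
  J₁ = J
  J₁≤J₂ : J₁ ≤ J₂
  J₁≤J₂ = s≤s⁻¹ (2^m<2^n⇒m<n (begin-strict
    2 ^ J₁            ≤⟨ 2^J≤P ⟩
    P₁                ≤⟨ m≤m*n P₁ (m * w) ⟩
    P₁ * (m * w)      ≡⟨ sym P₂≡P₁*m*w ⟩
    P₂                <⟨ d₂.P<2^[1+J] ⟩
    2 ^ suc J₂        ∎))
  2^J₂≡ : 2 ^ J₂ ≡ 2 ^ J₁ * 2 ^ (J₂ ∸ J₁)
  2^J₂≡ = trans (cong (2 ^_) (sym (m+[n∸m]≡n J₁≤J₂))) (^-distribˡ-+-* 2 J₁ (J₂ ∸ J₁))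
  m*P₂≡ : m * P₂ ≡ m * P₁ * (m * w)
  m*P₂≡ = trans (cong (m *_) P₂≡P₁*m*w) (sym (*-assoc m P₁ (m * w)))
  lower : B * (2 ^ J₁ * 2 ^ (J₂ ∸ J₁)) ≤ m * P₁ * (m * w)
  lower = begin
    B * (2 ^ J₁ * 2 ^ (J₂ ∸ J₁))  ≡⟨ cong₂ _*_ B≡B₂ (sym 2^J₂≡) ⟩
    B₂ * 2 ^ J₂                   ≤⟨ d₂.B*2^J≤m*P ⟩
    m * P₂                        ≡⟨ m*P₂≡ ⟩
    m * P₁ * (m * w)              ∎
  upper : m * P₁ * (m * w) < suc B * (2 ^ J₁ * 2 ^ (J₂ ∸ J₁))
  upper = begin-strict
    m * P₁ * (m * w)              ≡⟨ sym m*P₂≡ ⟩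
    m * P₂                        <⟨ d₂.m*P<[1+B]*2^J ⟩
    suc B₂ * 2 ^ J₂               ≡⟨ cong₂ (λ b x → suc b * x) (sym B≡B₂) 2^J₂≡ ⟩
    suc B * (2 ^ J₁ * 2 ^ (J₂ ∸ J₁)) ∎

-- opaque: unfolding this proof during unification makes checking amplify prohibitively slow.
opaque
  -- The leading digits of m ^ r, r = 0 … m, take at most m values, so two of them
  -- coincide; the quotient of those powers of m is then close to a power of 2.
  powerOfTwoNear : ∀ m → 1 < m → Σ ℕ λ R → Σ ℕ λ D → pred m * m ^ R < 2 ^ D × 2 ^ D < suc m * m ^ R
  powerOfTwoNear m 1<m = near (pigeonholeℕ m (λ r → B r ∸ m) B∸m<m)
    where
    instance
      m≢0 : NonZero m
      m≢0 = >-nonZero (<-trans z<s 1<m)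
    d : ∀ r → LeadingDigits m (m ^ r)
    d r = leadingDigits m (m ^ r) (m^n>0 m r)
    B : ℕ → ℕ
    B r = LeadingDigits.B (d r)
    m≤B : ∀ r → m ≤ B r
    m≤B r = LeadingDigits.m≤B (d r)
    B∸m<m : ∀ r → B r ∸ m < m
    B∸m<m r = +-cancelˡ-< m _ _
      (subst₂ _<_ (sym (m+[n∸m]≡n (m≤B r))) (cong (m +_) (+-identityʳ m)) (LeadingDigits.B<2m (d r)))
    m^r₂≡ : ∀ {r₁ r₂} → r₁ < r₂ → m ^ r₂ ≡ m ^ r₁ * (m * m ^ (r₂ ∸ suc r₁))
    m^r₂≡ {r₁} {r₂} r₁<r₂ = trans (cong (m ^_) (sym (trans (+-suc r₁ (r₂ ∸ suc r₁)) (m+[n∸m]≡n r₁<r₂))))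
                                  (^-distribˡ-+-* m r₁ (suc (r₂ ∸ suc r₁)))
    near : (Σ ℕ λ r₁ → Σ ℕ λ r₂ → r₁ < r₂ × B r₁ ∸ m ≡ B r₂ ∸ m) →
           Σ ℕ λ R → Σ ℕ λ D → pred m * m ^ R < 2 ^ D × 2 ^ D < suc m * m ^ R
    near (r₁ , r₂ , r₁<r₂ , B₁∸m≡B₂∸m) =
      r₂ ∸ suc r₁ , sameLeadingDigits⇒near {{m≢0}} {{m^n≢0 m (r₂ ∸ suc r₁)}}
      (d r₁) (d r₂) (m^r₂≡ r₁<r₂) (∸-cancelʳ-≡ (m≤B r₁) (m≤B r₂) B₁∸m≡B₂∸m)

-- Amplifying a counterexample

paddingSuffices : ∀ {m Q A x} .{{_ : NonZero m}} → 2 * A ≤ pred m * Q → pred m * Q < 2 * x →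
                  2 * x < suc m * Q → A ≤ x × 2 * x < (x ∸ A) + m * Q
paddingSuffices {suc m′} {Q} {A} {x} 2A≤m′Q m′Q<2x 2x<[2+m′]Q = A≤x , 2x<[x∸A]+mQ
  where
  open ≤-Reasoning
  A≤x : A ≤ x
  A≤x = <⇒≤ (*-cancelˡ-< 2 A x (≤-<-trans 2A≤m′Q m′Q<2x))
  [2+k]q+kq≡2[1+k]q : ∀ k q → suc (suc k) * q + k * q ≡ 2 * (suc k * q)
  [2+k]q+kq≡2[1+k]q = solve-∀
  x+A<mQ : x + A < suc m′ * Q
  x+A<mQ = *-cancelˡ-< 2 _ _ (begin-strict
    2 * (x + A)                ≡⟨ *-distribˡ-+ 2 x A ⟩
    2 * x + 2 * A              <⟨ +-mono-<-≤ 2x<[2+m′]Q 2A≤m′Q ⟩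
    suc (suc m′) * Q + m′ * Q  ≡⟨ [2+k]q+kq≡2[1+k]q m′ Q ⟩
    2 * (suc m′ * Q)           ∎)
  2x<[x∸A]+mQ : 2 * x < (x ∸ A) + suc m′ * Q
  2x<[x∸A]+mQ = begin-strict
    2 * x                ≡⟨ cong (x +_) (+-identityʳ x) ⟩
    x + x                ≡⟨ cong (_+ x) (sym (m∸n+n≡m A≤x)) ⟩
    (x ∸ A) + A + x      ≡⟨ +-assoc (x ∸ A) A x ⟩
    (x ∸ A) + (A + x)    ≡⟨ cong ((x ∸ A) +_) (+-comm A x) ⟩
    (x ∸ A) + (x + A)    <⟨ +-monoʳ-< (x ∸ A) x+A<mQ ⟩
    (x ∸ A) + suc m′ * Q ∎

amplify : ∀ {n} (F : Family n) → UnionClosed F → 2 ≤ mF F → 2 * aF F < mF F →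
          Σ ℕ λ N → Σ ℕ λ j → Σ (Family N) λ H → UnionClosed H × aF H ≤ 2 ^ j × 2 ^ suc j < mF H
amplify {n} F uc 2≤m 2a<m = pad (powerOfTwoNear (mF F) 2≤m)
  where
  instance
    m≢0 : NonZero (mF F)
    m≢0 = >-nonZero (<-trans z<s 2≤m)
  pad : (Σ ℕ λ R → Σ ℕ λ D → pred (mF F) * mF F ^ R < 2 ^ D × 2 ^ D < suc (mF F) * mF F ^ R) →
        Σ ℕ λ N → Σ ℕ λ j → Σ (Family N) λ H → UnionClosed H × aF H ≤ 2 ^ j × 2 ^ suc j < mF H
  pad (R , zero , [m-1]Q<1 , _) =
    contradiction [m-1]Q<1 (≤⇒≯ (*-mono-≤ (<⇒≤pred 2≤m) (m^n>0 (mF F) R)))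
  pad (R , suc j , [m-1]Q<2^[1+j] , 2^[1+j]<[m+1]Q) =
    t + suc R * n , j , H , extendByTops-unionClosed t G (^ᶠ-unionClosed F uc (suc R)) , aH≤2^j , 2^[1+j]<mH
    where
    Q : ℕ
    Q = mF F ^ R
    G : Family (suc R * n)
    G = F ^ᶠ suc R
    2aG≤[m-1]Q : 2 * aF G ≤ pred (mF F) * Q
    2aG≤[m-1]Q = begin
      2 * aF G          ≤⟨ *-monoʳ-≤ 2 (aF-^ᶠ-suc F R) ⟩
      2 * (aF F * Q)    ≡⟨ sym (*-assoc 2 (aF F) Q) ⟩
      2 * aF F * Q      ≤⟨ *-monoˡ-≤ Q (<⇒≤pred 2a<m) ⟩
      pred (mF F) * Q   ∎
      where open ≤-Reasoning
    padding : aF G ≤ 2 ^ j × 2 ^ suc j < (2 ^ j ∸ aF G) + mF F * Q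
    padding = paddingSuffices {mF F} {Q} {aF G} {2 ^ j} 2aG≤[m-1]Q [m-1]Q<2^[1+j] 2^[1+j]<[m+1]Q
    t : ℕ
    t = 2 ^ j ∸ aF G
    H : Family (t + suc R * n)
    H = extendByTops t G
    aH≤2^j : aF H ≤ 2 ^ j
    aH≤2^j = ≤-trans (aF-extendByTops t G) (≤-reflexive (m∸n+n≡m (proj₁ padding)))
    2^[1+j]<mH : 2 ^ suc j < mF H
    2^[1+j]<mH = subst (2 ^ suc j <_) (sym (trans (mF-extendByTops t G) (cong (t +_) (mF-^ᶠ F (suc R)))))
      (proj₂ padding)

mF>0⇒Nonempty : ∀ {n} (F : Family n) → 0 < mF F → Nonempty F
mF>0⇒Nonempty F 0<mF sets≡[] = <-irrefl refl (subst (λ As → 0 < length As) sets≡[] 0<mF)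

2^[1+i]≤3m⇒2≤m : ∀ {i m} → 1 ≤ i → 2 * 2 ^ i ≤ 3 * m → 2 ≤ m
2^[1+i]≤3m⇒2≤m {m = suc (suc _)} _ _ = s≤s (s≤s z≤n)
2^[1+i]≤3m⇒2≤m {m = zero} 1≤i h with ≤-trans (*-monoʳ-≤ 2 (^-monoʳ-≤ 2 1≤i)) h
... | ()
2^[1+i]≤3m⇒2≤m {m = suc zero} 1≤i h with ≤-trans (*-monoʳ-≤ 2 (^-monoʳ-≤ 2 1≤i)) h
... | s≤s (s≤s (s≤s ()))

theorem2p5 : (∀ (n a : ℕ) → 1 ≤ a → 1 ≤ n → ⌈log₂ a ⌉ + 1 ≤ n → FEq n (suc n) a) →
    (∀ (n m : ℕ) → 2 ≤ m → 1 ≤ n → ⌈log₂ m ⌉ ≤ n → GEq n (suc n) m) →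
    ∀ (m : ℕ) → 1 ≤ m →
    (Σ ℕ λ i → 1 ≤ i × 2 * 2 ^ i ≤ 3 * m × m ≤ 2 ^ i) →
    ∀ (n : ℕ) → 1 ≤ n → (F : Family n) → UnionClosed F → Nonempty F → mF F ≡ m →
    m ≤ 2 * aF F
theorem2p5 stable _ m _ (i , 1≤i , 2^[1+i]≤3m , _) n _ F uc _ refl =
  decidable-stable (mF F ≤? 2 * aF F) λ m≰2a →
    let N , j , H , ucH , aH≤2^j , 2^[1+j]<mH = amplify F uc (2^[1+i]≤3m⇒2≤m 1≤i 2^[1+i]≤3m) (≰⇒> m≰2a)
    in ¬¬-IsF N (2 ^ j) λ (v , isF) → <⇒≱ 2^[1+j]<mH (begin
      mF H       ≤⟨ proj₂ isF H ucH (mF>0⇒Nonempty H (≤-<-trans z≤n 2^[1+j]<mH)) aH≤2^j ⟩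
      v          ≤⟨ IsF[2^j]⇒≤2^[1+j] stable j N isF ⟩
      2 ^ suc j  ∎)
  where open ≤-Reasoning
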